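{- Let $H$ be a disconnected hypergraph with no singleton edges, whose connected components $G_1,G_2,\ldots,G_k$ are all not isolated vertices. Then $b(H)\leq b(G_1)+b(G_2)+\cdots+b(G_k)-k+1$.
   Context: A hypergraph $H$ consists of a nonempty finite vertex set $V(H)$ and a finite family $E(H)$ of edges, each a subset of $V(H)$. A path connecting $x$ and $y$ is an alternating sequence $x=v_1,e_1,v_2,\ldots,e_n,v_{n+1}=y$ of distinct vertices and distinct edges with $v_i,v_{i+1}\in e_i$. The connected components of $H$ are the hypergraphs whose vertex sets are the classes of the relation "connected by a path (or equal)" and whose edges are the edges of $H$ contained in that class; a component is an isolated vertex if it consists of a single vertex belonging to no edge. Round-based burning: let $F_0=\emptyset$. In each round $r=1,2,\ldots$ simultaneously: every vertex $v\notin F_{r-1}$ for which there is an edge $e$ with $|e|\geq 2$, $v\in e$ and $e\setminus\{v\}\subseteq F_{r-1}$ catches fire; and a chosen vertex $u_r\notin F_{r-1}$ (a source) is set on fire. $F_r$ is $F_{r-1}$ together with all vertices set on fire in round $r$. A sequence $(u_1,\ldots,u_k)$ with $u_r\notin F_{r-1}$ for all $r$ and $F_k=V(H)$ is a burning sequence; $b(H)$ is the minimum length of a burning sequence. -}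

module Defs where

open import Data.Nat using (ℕ; _≤_; _≤ᵇ_; _+_)
open import Data.Bool using (Bool; _∧_; _∨_)
open import Data.Fin using (Fin)
open import Data.Fin.Subset using (Subset; _∈_; _∉_; _⊆_; _∪_; _-_; ∣_∣; Nonempty; ⁅_⁆)
  renaming (⊥ to ∅)
open import Data.Fin.Subset.Properties using (_∈?_; _⊆?_)
open import Data.Vec using (tabulate; lookup)
open import Data.List using (List; []; _∷_; length; filter)
open import Data.Bool.ListAction using (any)
open import Data.Nat.ListAction using (sum)
import Data.List as L
open import Data.List.Relation.Unary.All using (All)
open import Data.List.Relation.Unary.Unique.Propositional using (Unique)
open import Data.Product using (Σ; ∃; _×_)
open import Relation.Binary.PropositionalEquality using (_≡_)
open import Relation.Nullary using (¬_; does)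

-- A hypergraph whose vertex set is a nonempty subset V of an ambient
-- finite type Fin N, with a finite family (list, repetitions allowed)
-- of edges, each a subset of V.
record Hypergraph (N : ℕ) : Set where
  field
    V        : Subset N
    E        : List (Subset N)
    E⊆V      : All (_⊆ V) E
    nonempty : Nonempty V
open Hypergraph public

-- Edge indices (edges are distinguished by their position in the family).
EdgeIx : ∀ {N} → Hypergraph N → Set
EdgeIx H = Fin (length (E H))

edge : ∀ {N} (H : Hypergraph N) → EdgeIx H → Subset N
edge H i = L.lookup (E H) i

data Chain {N} (H : Hypergraph N) : Fin N → Fin N → List (Fin N) → List (EdgeIx H) → Set where
  single : (x : Fin N) → Chain H x x (x ∷ []) []
  step   : ∀ {x v y vs es} (e : EdgeIx H) → x ∈ edge H e → v ∈ edge H e →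
           Chain H v y (v ∷ vs) es → Chain H x y (x ∷ v ∷ vs) (e ∷ es)

Path : ∀ {N} → Hypergraph N → Fin N → Fin N → Set
Path H x y = Σ (List (Fin _)) λ vs → Σ (List (EdgeIx H)) λ es →
  Chain H x y vs es × Unique vs × Unique es

Connected : ∀ {N} → Hypergraph N → Fin N → Fin N → Set
Connected H x y = x ≡ y Data.Sum.⊎ Path H x y
  where import Data.Sum

Disconnected : ∀ {N} → Hypergraph N → Set
Disconnected H = ¬ (∀ x y → x ∈ V H → y ∈ V H → Connected H x y)

-- G is a connected component of H: its vertex set is the class of some
-- vertex x of H, and its edges are the edges of H contained in that class
-- (in their original order / multiplicity).
IsComponent : ∀ {N} → Hypergraph N → Hypergraph N → Set
IsComponent H G =
  (Σ (Fin _) λ x → x ∈ V H × (∀ y → (y ∈ V G → y ∈ V H × Connected H x y)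
                                   × (y ∈ V H × Connected H x y → y ∈ V G)))
  × E G ≡ filter (_⊆? V G) (E H)

IsolatedVertex : ∀ {N} → Hypergraph N → Set
IsolatedVertex G = Σ (Fin _) λ x → V G ≡ ⁅ x ⁆ × All (x ∉_) (E G)

spread : ∀ {N} → List (Subset N) → Subset N → Subset N
spread Es F = tabulate λ v →
  lookup F v ∨ any (λ e → does (v ∈? e) ∧ (2 ≤ᵇ ∣ e ∣) ∧ does ((e - v) ⊆? F)) Es

burnRound : ∀ {N} → List (Subset N) → Subset N → Fin N → Subset N
burnRound Es F u = spread Es F ∪ ⁅ u ⁆

BurnsFrom : ∀ {N} → Hypergraph N → Subset N → List (Fin N) → Set
BurnsFrom H F []       = F ≡ V H
BurnsFrom H F (u ∷ us) = u ∈ V H × u ∉ F × BurnsFrom H (burnRound (E H) F u) us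

IsBurningSeq : ∀ {N} → Hypergraph N → List (Fin N) → Set
IsBurningSeq H us = BurnsFrom H ∅ us

IsBurningNumber : ∀ {N} → Hypergraph N → ℕ → Set
IsBurningNumber H b =
  (Σ (List (Fin _)) λ us → IsBurningSeq H us × length us ≡ b)
  × (∀ us → IsBurningSeq H us → b ≤ length us)

Σ[<_]_ : (k : ℕ) → (Fin k → ℕ) → ℕ
Σ[< k ] f = sum (L.tabulate f)

-- Burn the components one after another.  Inside H, a source sequence of G_i lights on V(G_i)
-- exactly what it lights in G_i, since the edges of H meeting V(G_i) are those of G_i; and a
-- component none of whose vertices burns stays unburnt, since an edge of size ≥ 2 spreads fire
-- only from a second burning vertex.  Run each component but the last with its optimal sequence
-- minus the final source ℓ: every vertex except ℓ then burns one round later, and ℓ lies on an edge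
-- of size ≥ 2 (no singleton edges, no isolated vertices), so the component is burnt after any two
-- further rounds.  The last component gets its full sequence, of length ≥ 2, which completes all
-- the others.  This uses Σ (b(G_i) − 1) + 1 sources.

module Submission where

open import Defs
open import Data.Bool using (Bool; true; T)
open import Data.Bool.Properties using (T-∨; T-≡)
open import Data.Empty using (⊥-elim)
open import Data.Fin using (Fin; _≟_)
open import Data.Fin.Subset using (Subset; _∈_; _∉_; _⊆_; _─_; _-_; ∣_∣; Nonempty; ⁅_⁆; inside; outside)
  renaming (⊥ to ∅)
open import Data.Fin.Subset.Properties
  using (_∈?_; _⊆?_; nonempty?; ∉⊥; ⊥⊆; ⊆-antisym; x∈⁅x⁆; x∈⁅y⁆⇒x≡y; x∉⁅y⁆⇒x≢y; ∣⁅x⁆∣≡1; x∈p∪q⁻; x∈p∪q⁺;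
         p⊆q⇒∣p∣≤∣q∣; p─q⊆p; x∈p∧x≢y⇒x∈p-y; x∈p⇒∣p-x∣<∣p∣)
open import Data.List using (List; []; _∷_; _++_; _∷ʳ_; length; map; foldl; allFin; initLast; _∷ʳ′_)
open import Data.List.Properties
  using (foldl-++; foldl-∷ʳ; length-++; length-++-≤ʳ; length-tabulate; map-tabulate; map-cong)
open import Data.List.Membership.Propositional using (find; lose) renaming (_∈_ to _∈ₗ_; _∉_ to _∉ₗ_)
open import Data.List.Membership.Propositional.Properties using (∈-filter⁺; ∈-filter⁻; ∈-lookup; ∈-allFin)
open import Data.List.Relation.Binary.Subset.Propositional using () renaming (_⊆_ to _⊆ₗ_)
open import Data.List.Relation.Binary.Subset.Propositional.Properties using (⊆-trans; ∈-∷⁺ʳ; ∷⁺ʳ; xs⊆x∷xs)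
open import Data.List.Relation.Unary.All using (All; []; _∷_)
import Data.List.Relation.Unary.All as All
open import Data.List.Relation.Unary.All.Properties using (anti-mono; ¬Any⇒All¬)
open import Data.List.Relation.Unary.AllPairs using ([]; _∷_)
open import Data.List.Relation.Unary.Any using (here; there)
import Data.List.Relation.Unary.Any as Any
open import Data.List.Relation.Unary.Any.Properties using (any⁺; any⁻; lookup-index)
open import Data.List.Relation.Unary.Unique.Propositional using (Unique)
open import Data.List.Relation.Unary.Unique.Propositional.Properties using (allFin⁺)
open import Data.Nat using (ℕ; suc; _+_; _≤_; s≤s; z≤n)
open import Data.Nat.ListAction using (sum)
open import Data.Nat.Properties
  using (_≤?_; ≤-trans; ≤⇒≯; ≤∧≢⇒<; +-identityʳ; +-suc; +-assoc; +-comm; +-monoˡ-≤; module ≤-Reasoning)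
open import Data.Product using (∃; _×_; _,_; proj₁; proj₂)
import Data.Product as Product
open import Data.Sum using (_⊎_; inj₁; inj₂)
import Data.Sum as Sum
open import Data.Unit using (⊤)
import Data.Vec as Vec
open import Data.Vec using (_∷_; tabulate; lookup)
open import Data.Vec.Properties using (lookup∘tabulate; []=⇒lookup; lookup⇒[]=)
open import Function using (_∘_; id; Equivalence)
open import Relation.Binary.PropositionalEquality
  using (_≡_; _≢_; refl; sym; trans; cong; cong₂; subst; module ≡-Reasoning)
open import Relation.Nullary using (¬_; Dec; does; yes; no; _because_; _×-dec_)
open import Relation.Nullary.Decidable using (dec-true)
open import Relation.Nullary.Reflects using (invert)

open Equivalence using (to; from)

private
  variable
    N : ℕ
    x y v u : Fin N
    p F : Subset N
    Es : List (Subset N)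

∷ʳ-split : ∀ {A : Set} (xs : List A) → xs ≢ [] → ∃ λ ys → ∃ λ y → xs ≡ ys ∷ʳ y
∷ʳ-split xs xs≢[] with initLast xs
... | []       = ⊥-elim (xs≢[] refl)
... | ys ∷ʳ′ y = ys , y , refl

x∈p─q⇒x∉q : ∀ (p q : Subset N) → x ∈ p ─ q → x ∉ q
x∈p─q⇒x∉q (inside ∷ p) (outside ∷ q) Vec.here      ()
x∈p─q⇒x∉q (_ ∷ p)      (_ ∷ q)       (Vec.there m) (Vec.there x∈q) = x∈p─q⇒x∉q p q m x∈q

x∈p-y⁻ : x ∈ p - y → x ∈ p × x ≢ y
x∈p-y⁻ {p = p} {y} m = p─q⊆p p ⁅ y ⁆ m , x∉⁅y⁆⇒x≢y (x∈p─q⇒x∉q p ⁅ y ⁆ m)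

2≤∣p∣⇒Nonempty[p-x] : 2 ≤ ∣ p ∣ → Nonempty (p - x)
2≤∣p∣⇒Nonempty[p-x] {p = p} {x} 2≤∣p∣ with nonempty? (p - x)
... | yes ne = ne
... | no empty = ⊥-elim (≤⇒≯ ∣p∣≤1 2≤∣p∣)
  where
    p⊆⁅x⁆ : p ⊆ ⁅ x ⁆
    p⊆⁅x⁆ {w} w∈p with w ≟ x
    ... | yes refl = x∈⁅x⁆ x
    ... | no w≢x = ⊥-elim (empty (w , x∈p∧x≢y⇒x∈p-y w∈p w≢x))
    ∣p∣≤1 : ∣ p ∣ ≤ 1
    ∣p∣≤1 = subst (∣ p ∣ ≤_) (∣⁅x⁆∣≡1 x) (p⊆q⇒∣p∣≤∣q∣ p⊆⁅x⁆)

x∈p∧∣p∣≢1⇒2≤∣p∣ : x ∈ p → ∣ p ∣ ≢ 1 → 2 ≤ ∣ p ∣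
x∈p∧∣p∣≢1⇒2≤∣p∣ x∈p ∣p∣≢1 = ≤∧≢⇒< (≤-trans (s≤s z≤n) (x∈p⇒∣p-x∣<∣p∣ x∈p)) (∣p∣≢1 ∘ sym)

∈-tabulate⁻ : ∀ {f : Fin N → Bool} → x ∈ tabulate f → T (f x)
∈-tabulate⁻ {x = x} {f} m = from T-≡ (trans (sym (lookup∘tabulate f x)) ([]=⇒lookup m))

∈-tabulate⁺ : ∀ {f : Fin N → Bool} → T (f x) → x ∈ tabulate f
∈-tabulate⁺ {x = x} {f} t = lookup⇒[]= x (tabulate f) (trans (lookup∘tabulate f x) (to T-≡ t))

∈⇒T-lookup : x ∈ p → T (lookup p x)
∈⇒T-lookup m = from T-≡ ([]=⇒lookup m)

T-lookup⇒∈ : T (lookup p x) → x ∈ p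
T-lookup⇒∈ {p = p} {x} t = lookup⇒[]= x p (to T-≡ t)

Kindles : Subset N → Fin N → Subset N → Set
Kindles F v e = v ∈ e × 2 ≤ ∣ e ∣ × e - v ⊆ F

-- does (Kindles? F v e) is, definitionally, the Boolean test used by spread.
Kindles? : ∀ F (v : Fin N) e → Dec (Kindles F v e)
Kindles? F v e = v ∈? e ×-dec 2 ≤? ∣ e ∣ ×-dec (e - v) ⊆? F

T-does⁻ : ∀ {A : Set} (a? : Dec A) → T (does a?) → A
T-does⁻ (true because [a]) _ = invert [a]

T-does⁺ : ∀ {A : Set} (a? : Dec A) → A → T (does a?)
T-does⁺ a? a = from T-≡ (dec-true a? a)

Ignites : List (Subset N) → Subset N → Fin N → Set
Ignites Es F v = ∃ λ e → e ∈ₗ Es × Kindles F v e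

∈-spread⁻ : ∀ Es → v ∈ spread Es F → v ∈ F ⊎ Ignites Es F v
∈-spread⁻ Es m with to T-∨ (∈-tabulate⁻ m)
... | inj₁ t = inj₁ (T-lookup⇒∈ t)
... | inj₂ t with find (any⁻ _ Es t)
...   | e , e∈Es , k = inj₂ (e , e∈Es , T-does⁻ (Kindles? _ _ e) k)

∈-spread⁺ : ∀ Es → v ∈ F ⊎ Ignites Es F v → v ∈ spread Es F
∈-spread⁺ _ (inj₁ v∈F) = ∈-tabulate⁺ (from T-∨ (inj₁ (∈⇒T-lookup v∈F)))
∈-spread⁺ _ (inj₂ (e , e∈Es , k)) = ∈-tabulate⁺ (from T-∨ (inj₂ (any⁺ _ (lose e∈Es (T-does⁺ (Kindles? _ _ _) k)))))

∈-burnRound⁻ : ∀ Es → v ∈ burnRound Es F u → v ∈ F ⊎ Ignites Es F v ⊎ v ≡ u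
∈-burnRound⁻ {F = F} {u = u} Es m with x∈p∪q⁻ (spread Es F) ⁅ u ⁆ m
... | inj₁ v∈spread = Sum.assocʳ (inj₁ (∈-spread⁻ Es v∈spread))
... | inj₂ v∈⁅u⁆    = inj₂ (inj₂ (x∈⁅y⁆⇒x≡y u v∈⁅u⁆))

F⊆burnRound : ∀ Es → F ⊆ burnRound Es F u
F⊆burnRound Es v∈F = x∈p∪q⁺ (inj₁ (∈-spread⁺ Es (inj₁ v∈F)))

ignites⇒∈burnRound : Ignites Es F v → v ∈ burnRound Es F u
ignites⇒∈burnRound {Es = Es} ign = x∈p∪q⁺ (inj₁ (∈-spread⁺ Es (inj₂ ign)))

source∈burnRound : ∀ Es → u ∈ burnRound Es F u
source∈burnRound {u = u} _ = x∈p∪q⁺ (inj₂ (x∈⁅x⁆ u))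

¬ignites-∅ : ¬ Ignites Es ∅ v
¬ignites-∅ (e , _ , _ , 2≤∣e∣ , e-v⊆∅) = ∉⊥ (e-v⊆∅ (proj₂ (2≤∣p∣⇒Nonempty[p-x] 2≤∣e∣)))

∈-burnRound-∅ : ∀ Es → v ∈ burnRound Es ∅ u → v ≡ u
∈-burnRound-∅ Es m with ∈-burnRound⁻ Es m
... | inj₁ v∈∅          = ⊥-elim (∉⊥ v∈∅)
... | inj₂ (inj₁ ign)   = ⊥-elim (¬ignites-∅ ign)
... | inj₂ (inj₂ v≡u)   = v≡u

run : List (Subset N) → Subset N → List (Fin N) → Subset N
run Es = foldl (burnRound Es)

⊆-run : ∀ Es us → F ⊆ run Es F us
⊆-run Es []       v∈F = v∈F
⊆-run Es (u ∷ us) v∈F = ⊆-run Es us (F⊆burnRound Es v∈F)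

Legal : Hypergraph N → Subset N → List (Fin N) → Set
Legal H F []       = ⊤
Legal H F (u ∷ us) = u ∈ V H × u ∉ F × Legal H (burnRound (E H) F u) us

BurnsFrom⁻ : ∀ (H : Hypergraph N) {F} us → BurnsFrom H F us → Legal H F us × run (E H) F us ≡ V H
BurnsFrom⁻ H []       F≡V               = _ , F≡V
BurnsFrom⁻ H (u ∷ us) (u∈V , u∉F , rest) = Product.map₁ (λ legal → u∈V , u∉F , legal) (BurnsFrom⁻ H us rest)

BurnsFrom⁺ : ∀ (H : Hypergraph N) {F} us → Legal H F us → run (E H) F us ≡ V H → BurnsFrom H F us
BurnsFrom⁺ H []       _                    F≡V = F≡V
BurnsFrom⁺ H (u ∷ us) (u∈V , u∉F , legal) eq  = u∈V , u∉F , BurnsFrom⁺ H us legal eq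

Legal-++⁻ : ∀ (H : Hypergraph N) {F} us {vs} → Legal H F (us ++ vs) → Legal H F us
Legal-++⁻ H []       _                    = _
Legal-++⁻ H (u ∷ us) (u∈V , u∉F , legal) = u∈V , u∉F , Legal-++⁻ H us legal

Legal⇒sources∈V : ∀ (H : Hypergraph N) {F} us → Legal H F us → All (_∈ V H) us
Legal⇒sources∈V H []       _                  = []
Legal⇒sources∈V H (u ∷ us) (u∈V , _ , legal) = u∈V ∷ Legal⇒sources∈V H us legal

BurnsFrom-++ : ∀ (H : Hypergraph N) {F} us {vs} → Legal H F us → BurnsFrom H (run (E H) F us) vs →
               BurnsFrom H F (us ++ vs)
BurnsFrom-++ H []       _                    burns = burns
BurnsFrom-++ H (u ∷ us) (u∈V , u∉F , legal) burns = u∈V , u∉F , BurnsFrom-++ H us legal burns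

AgreeOn : Subset N → Subset N → Subset N → Set
AgreeOn W F F′ = ∀ {v} → v ∈ W → (v ∈ F → v ∈ F′) × (v ∈ F′ → v ∈ F)

Unburnt : Subset N → Subset N → Set
Unburnt W F = ∀ {v} → v ∈ W → v ∉ F

Unburnt⇒AgreeOn-∅ : ∀ {W : Subset N} → Unburnt W F → AgreeOn W F ∅
Unburnt⇒AgreeOn-∅ unburnt v∈W = (λ v∈F → ⊥-elim (unburnt v∈W v∈F)) , (λ v∈∅ → ⊥-elim (∉⊥ v∈∅))

Settled : Hypergraph N → Subset N → Subset N → Set
Settled H W F = ∀ us → 2 ≤ length us → W ⊆ run (E H) F us

Settled-run : ∀ (H : Hypergraph N) {W F} → Settled H W F → ∀ vs → Settled H W (run (E H) F vs)
Settled-run H {W} {F} settled vs us 2≤∣us∣ =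
  subst (W ⊆_) (foldl-++ (burnRound (E H)) F vs us) (settled (vs ++ us) (≤-trans 2≤∣us∣ (length-++-≤ʳ us {vs})))

run-⊆V : ∀ (H : Hypergraph N) {F} us → F ⊆ V H → All (_∈ V H) us → run (E H) F us ⊆ V H
run-⊆V H []       F⊆V []           = F⊆V
run-⊆V H (u ∷ us) F⊆V (u∈V ∷ us∈V) = run-⊆V H us burnRound⊆V us∈V
  where
    burnRound⊆V : burnRound (E H) _ u ⊆ V H
    burnRound⊆V m with ∈-burnRound⁻ (E H) m
    ... | inj₁ v∈F                     = F⊆V v∈F
    ... | inj₂ (inj₁ (_ , e∈E , v∈e , _)) = All.lookup (E⊆V H) e∈E v∈e
    ... | inj₂ (inj₂ refl)             = u∈V

2≤length-burningSeq : ∀ (G : Hypergraph N) {e} → e ⊆ V G → 2 ≤ ∣ e ∣ → ∀ us → IsBurningSeq G us → 2 ≤ length us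
2≤length-burningSeq G _ _ [] ∅≡V =
  ⊥-elim (∉⊥ (subst (proj₁ (nonempty G) ∈_) (sym ∅≡V) (proj₂ (nonempty G))))
2≤length-burningSeq G e⊆V 2≤∣e∣ (u ∷ []) (_ , _ , burnt≡V)
  with 2≤∣p∣⇒Nonempty[p-x] {x = u} 2≤∣e∣
... | w , w∈e-u = ⊥-elim (w≢u (∈-burnRound-∅ (E G) (subst (w ∈_) (sym burnt≡V) (e⊆V w∈e))))
  where
    w∈e = proj₁ (x∈p-y⁻ w∈e-u)
    w≢u = proj₂ (x∈p-y⁻ w∈e-u)
2≤length-burningSeq G _ _ (_ ∷ _ ∷ _) _ = s≤s (s≤s z≤n)

module Connectivity {N} (H : Hypergraph N) where

  Connected⇒Path : ∀ {x y} → Connected H x y → Path H x y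
  Connected⇒Path (inj₁ refl) = _ , _ , single _ , [] ∷ [] , []
  Connected⇒Path (inj₂ path) = path

  record Shortcut (x w : Fin N) (vs : List (Fin N)) (es : List (EdgeIx H)) (e : EdgeIx H) : Set where
    field
      {vs′}     : List (Fin N)
      {es′}     : List (EdgeIx H)
      chain     : Chain H x w (x ∷ vs′) es′
      unique-vs : Unique (x ∷ vs′)
      unique-es : Unique es′
      vs′⊆      : x ∷ vs′ ⊆ₗ w ∷ vs
      es′⊆      : es′ ⊆ₗ e ∷ es

  open Shortcut

  head∈ : ∀ {x y vs es} → Chain H x y vs es → x ∈ₗ vs
  head∈ (single _)       = here refl
  head∈ (step _ _ _ _)   = here refl

  -- Follow the path until it reaches w or a vertex of e, then jump to w along e.
  shortcut : ∀ {x v vs es} w e → Chain H x v vs es → Unique vs → Unique es →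
             v ∈ edge H e → w ∈ edge H e → Shortcut x w vs es e
  shortcut {x} w e ch uv ue v∈e w∈e with x ≟ w
  ... | yes refl = record
    { chain = single w ; unique-vs = [] ∷ [] ; unique-es = []
    ; vs′⊆ = λ { (here refl) → here refl } ; es′⊆ = λ () }
  ... | no x≢w with x ∈? edge H e
  ...   | yes x∈e = record
    { chain = step e x∈e w∈e (single w) ; unique-vs = (x≢w ∷ []) ∷ [] ∷ [] ; unique-es = [] ∷ []
    ; vs′⊆ = λ { (here refl) → there (head∈ ch) ; (there (here refl)) → here refl }
    ; es′⊆ = λ { (here refl) → here refl } }
  shortcut w e (single _) _ _ v∈e _ | no _ | no x∉e = ⊥-elim (x∉e v∈e)
  shortcut {x} w e (step e₁ x∈e₁ v₁∈e₁ rest) (x∉vs ∷ uv) (e₁∉es ∷ ue) v∈e w∈e | no x≢w | no x∉e =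
    record
      { chain     = step e₁ x∈e₁ v₁∈e₁ (chain r)
      ; unique-vs = anti-mono (vs′⊆ r) (x≢w ∷ x∉vs) ∷ unique-vs r
      ; unique-es = anti-mono (es′⊆ r) (e₁≢e ∷ e₁∉es) ∷ unique-es r
      ; vs′⊆      = cons-⊆ (vs′⊆ r)
      ; es′⊆      = cons-⊆ (es′⊆ r)
      }
    where
      r = shortcut w e rest uv ue v∈e w∈e
      e₁≢e : e₁ ≢ e
      e₁≢e refl = x∉e x∈e₁
      cons-⊆ : ∀ {A : Set} {a b : A} {as bs} → as ⊆ₗ b ∷ bs → a ∷ as ⊆ₗ b ∷ a ∷ bs
      cons-⊆ {a = a} {b} {bs = bs} as⊆ = ∈-∷⁺ʳ (there (here refl)) (⊆-trans as⊆ (∷⁺ʳ b (xs⊆x∷xs bs a)))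

  Connected-extend : ∀ {x v w} → Connected H x v → ∀ e → v ∈ edge H e → w ∈ edge H e → Connected H x w
  Connected-extend c e v∈e w∈e with Connected⇒Path c
  ... | _ , _ , ch , uv , ue = inj₂ (_ , _ , chain r , unique-vs r , unique-es r)
    where r = shortcut _ e ch uv ue v∈e w∈e

  Connected-chain : ∀ {x v w vs es} → Connected H x v → Chain H v w vs es → Connected H x w
  Connected-chain c (single _)          = c
  Connected-chain c (step e v∈e u∈e ch) = Connected-chain (Connected-extend c e v∈e u∈e) ch

  Connected-trans : ∀ {x y z} → Connected H x y → Connected H y z → Connected H x z
  Connected-trans c (inj₁ refl)            = c
  Connected-trans c (inj₂ (_ , _ , ch , _)) = Connected-chain c ch

  Chain⇒Connected⁻¹ : ∀ {x y vs es} → Chain H x y vs es → Connected H y x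
  Chain⇒Connected⁻¹ (single _)          = inj₁ refl
  Chain⇒Connected⁻¹ (step e x∈e v∈e ch) = Connected-extend (Chain⇒Connected⁻¹ ch) e v∈e x∈e

  Connected-sym : ∀ {x y} → Connected H x y → Connected H y x
  Connected-sym (inj₁ refl)             = inj₁ refl
  Connected-sym (inj₂ (_ , _ , ch , _)) = Chain⇒Connected⁻¹ ch

module ComponentOf {N} (H G : Hypergraph N) (isComponent : IsComponent H G) where

  open Connectivity H

  root : Fin N
  root = proj₁ (proj₁ isComponent)

  ∈V⁻ : ∀ {v} → v ∈ V G → v ∈ V H × Connected H root v
  ∈V⁻ {v} = proj₁ (proj₂ (proj₂ (proj₁ isComponent)) v)

  ∈V⁺ : ∀ {v} → v ∈ V H → Connected H root v → v ∈ V G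
  ∈V⁺ {v} v∈H c = proj₂ (proj₂ (proj₂ (proj₁ isComponent)) v) (v∈H , c)

  V⊆V : V G ⊆ V H
  V⊆V = proj₁ ∘ ∈V⁻

  connected : ∀ {v w} → v ∈ V G → w ∈ V G → Connected H v w
  connected v∈G w∈G = Connected-trans (Connected-sym (proj₂ (∈V⁻ v∈G))) (proj₂ (∈V⁻ w∈G))

  ∈V-closed : ∀ {v w} → v ∈ V G → w ∈ V H → Connected H v w → w ∈ V G
  ∈V-closed v∈G w∈H c = ∈V⁺ w∈H (Connected-trans (proj₂ (∈V⁻ v∈G)) c)

  edge⊆V : ∀ {v e} → v ∈ V G → e ∈ₗ E H → v ∈ e → e ⊆ V G
  edge⊆V {v} v∈G e∈H v∈e {w} w∈e =
    ∈V-closed v∈G (All.lookup (E⊆V H) e∈H w∈e)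
      (Connected-extend (inj₁ refl) (Any.index e∈H)
        (subst (v ∈_) (lookup-index e∈H) v∈e) (subst (w ∈_) (lookup-index e∈H) w∈e))

  edge∈G : ∀ {e} → e ∈ₗ E H → e ⊆ V G → e ∈ₗ E G
  edge∈G e∈H e⊆G = subst (_ ∈ₗ_) (sym (proj₂ isComponent)) (∈-filter⁺ (_⊆? V G) e∈H e⊆G)

  edge∈H : ∀ {e} → e ∈ₗ E G → e ∈ₗ E H
  edge∈H e∈G = proj₁ (∈-filter⁻ (_⊆? V G) (subst (_ ∈ₗ_) (proj₂ isComponent) e∈G))

  ignites-H⇒G : ∀ {F F′ v} → AgreeOn (V G) F F′ → v ∈ V G → Ignites (E H) F v → Ignites (E G) F′ v
  ignites-H⇒G agree v∈G (e , e∈H , v∈e , 2≤∣e∣ , e-v⊆F) =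
    e , edge∈G e∈H e⊆G , v∈e , 2≤∣e∣ , λ w∈e-v → proj₁ (agree (e⊆G (proj₁ (x∈p-y⁻ w∈e-v)))) (e-v⊆F w∈e-v)
    where e⊆G = edge⊆V v∈G e∈H v∈e

  ignites-G⇒H : ∀ {F F′ v} → AgreeOn (V G) F F′ → Ignites (E G) F′ v → Ignites (E H) F v
  ignites-G⇒H agree (e , e∈G , v∈e , 2≤∣e∣ , e-v⊆F′) =
    e , edge∈H e∈G , v∈e , 2≤∣e∣ , λ w∈e-v → proj₂ (agree (e⊆G (proj₁ (x∈p-y⁻ w∈e-v)))) (e-v⊆F′ w∈e-v)
    where e⊆G = All.lookup (E⊆V G) e∈G

  AgreeOn-burnRound : ∀ {F F′} → AgreeOn (V G) F F′ → ∀ u →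
                      AgreeOn (V G) (burnRound (E H) F u) (burnRound (E G) F′ u)
  AgreeOn-burnRound agree u v∈G = H⇒G , G⇒H
    where
      H⇒G : _ ∈ burnRound (E H) _ u → _ ∈ burnRound (E G) _ u
      H⇒G m with ∈-burnRound⁻ (E H) m
      ... | inj₁ v∈F         = F⊆burnRound (E G) (proj₁ (agree v∈G) v∈F)
      ... | inj₂ (inj₁ ign)  = ignites⇒∈burnRound (ignites-H⇒G agree v∈G ign)
      ... | inj₂ (inj₂ refl) = source∈burnRound (E G)
      G⇒H : _ ∈ burnRound (E G) _ u → _ ∈ burnRound (E H) _ u
      G⇒H m with ∈-burnRound⁻ (E G) m
      ... | inj₁ v∈F′        = F⊆burnRound (E H) (proj₂ (agree v∈G) v∈F′)
      ... | inj₂ (inj₁ ign)  = ignites⇒∈burnRound (ignites-G⇒H agree ign)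
      ... | inj₂ (inj₂ refl) = source∈burnRound (E H)

  AgreeOn-run : ∀ {F F′} → AgreeOn (V G) F F′ → ∀ us → AgreeOn (V G) (run (E H) F us) (run (E G) F′ us)
  AgreeOn-run agree []       = agree
  AgreeOn-run agree (u ∷ us) = AgreeOn-run (AgreeOn-burnRound agree u) us

  Legal-lift : ∀ {F F′} → AgreeOn (V G) F F′ → ∀ us → Legal G F′ us → Legal H F us
  Legal-lift agree []       _                      = _
  Legal-lift agree (u ∷ us) (u∈G , u∉F′ , legal) =
    V⊆V u∈G , (λ u∈F → u∉F′ (proj₁ (agree u∈G) u∈F)) , Legal-lift (AgreeOn-burnRound agree u) us legal

  Unburnt-burnRound : ∀ {F u} → Unburnt (V G) F → u ∉ V G → Unburnt (V G) (burnRound (E H) F u)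
  Unburnt-burnRound unburnt u∉G v∈G m with ∈-burnRound⁻ (E H) m
  ... | inj₁ v∈F         = unburnt v∈G v∈F
  ... | inj₂ (inj₂ refl) = u∉G v∈G
  ... | inj₂ (inj₁ (e , e∈H , v∈e , 2≤∣e∣ , e-v⊆F)) with 2≤∣p∣⇒Nonempty[p-x] 2≤∣e∣
  ...   | w , w∈e-v = unburnt (edge⊆V v∈G e∈H v∈e (proj₁ (x∈p-y⁻ w∈e-v))) (e-v⊆F w∈e-v)

  Unburnt-run : ∀ {F} → Unburnt (V G) F → ∀ us → All (_∉ V G) us → Unburnt (V G) (run (E H) F us)
  Unburnt-run unburnt []       []             = unburnt
  Unburnt-run unburnt (u ∷ us) (u∉G ∷ us∉G) = Unburnt-run (Unburnt-burnRound unburnt u∉G) us us∉G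

  module _ (noSingleton : All (λ e → ∣ e ∣ ≢ 1) (E H)) (notIsolated : ¬ IsolatedVertex G) where

    big-edge : ∀ {v} → v ∈ V G → ∃ λ e → e ∈ₗ E G × v ∈ e × 2 ≤ ∣ e ∣
    big-edge {v} v∈G with Any.any? (v ∈?_) (E G)
    ... | yes v∈some with find v∈some
    ...   | e , e∈G , v∈e = e , e∈G , v∈e , x∈p∧∣p∣≢1⇒2≤∣p∣ v∈e (All.lookup noSingleton (edge∈H e∈G))
    big-edge {v} v∈G | no v∈none =
      ⊥-elim (notIsolated (v , ⊆-antisym V⊆⁅v⁆ ⁅v⁆⊆V , ¬Any⇒All¬ (E G) v∈none))
      where
        ⁅v⁆⊆V : ⁅ v ⁆ ⊆ V G
        ⁅v⁆⊆V w∈⁅v⁆ = subst (_∈ V G) (sym (x∈⁅y⁆⇒x≡y v w∈⁅v⁆)) v∈G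
        -- A path from v to another vertex of G starts with an edge of G through v.
        V⊆⁅v⁆ : V G ⊆ ⁅ v ⁆
        V⊆⁅v⁆ w∈G with connected v∈G w∈G
        ... | inj₁ refl                            = x∈⁅x⁆ v
        ... | inj₂ (_ , _ , single _ , _)           = x∈⁅x⁆ v
        ... | inj₂ (_ , _ , step e v∈e _ _ , _)     =
          ⊥-elim (v∈none (lose (edge∈G (∈-lookup e) (edge⊆V v∈G (∈-lookup e) v∈e)) v∈e))

    Settled-one-round-before : ∀ {F F′ ℓ} → AgreeOn (V G) F F′ → burnRound (E G) F′ ℓ ≡ V G →
                               Settled H (V G) F
    Settled-one-round-before _ _ (_ ∷ []) (s≤s ())
    Settled-one-round-before {F} {F′} {ℓ} agree burnt≡V (u ∷ u′ ∷ us) _ v∈G =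
      ⊆-run (E H) us (burnt-after-two v∈G)
      where
        F₁ = burnRound (E H) F u
        burnt-after-one : ∀ {v} → v ∈ V G → v ≢ ℓ → v ∈ F₁
        burnt-after-one v∈G v≢ℓ with ∈-burnRound⁻ (E G) (subst (_ ∈_) (sym burnt≡V) v∈G)
        ... | inj₁ v∈F′         = F⊆burnRound (E H) (proj₂ (agree v∈G) v∈F′)
        ... | inj₂ (inj₁ ign)   = ignites⇒∈burnRound (ignites-G⇒H agree ign)
        ... | inj₂ (inj₂ v≡ℓ)   = ⊥-elim (v≢ℓ v≡ℓ)
        burnt-after-two : V G ⊆ burnRound (E H) F₁ u′
        burnt-after-two {v} v∈G with v ≟ ℓ
        ... | no v≢ℓ  = F⊆burnRound (E H) (burnt-after-one v∈G v≢ℓ)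
        ... | yes refl with big-edge v∈G
        ...   | e , e∈G , v∈e , 2≤∣e∣ = ignites⇒∈burnRound (e , edge∈H e∈G , v∈e , 2≤∣e∣ , e-v⊆F₁)
          where
            e-v⊆F₁ : e - v ⊆ F₁
            e-v⊆F₁ w∈e-v = burnt-after-one (All.lookup (E⊆V G) e∈G (proj₁ (x∈p-y⁻ w∈e-v))) (proj₂ (x∈p-y⁻ w∈e-v))

    burn-all-but-last : ∀ {F} → Unburnt (V G) F → ∀ us ℓ → IsBurningSeq G (us ∷ʳ ℓ) →
                        Legal H F us × All (_∈ V G) us × Settled H (V G) (run (E H) F us)
    burn-all-but-last unburnt us ℓ burns with BurnsFrom⁻ G (us ∷ʳ ℓ) burns
    ... | legal , burnt≡V =
      Legal-lift agree₀ us legalᵤ ,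
      Legal⇒sources∈V G us legalᵤ ,
      Settled-one-round-before (AgreeOn-run agree₀ us) (trans (sym (foldl-∷ʳ (burnRound (E G)) ∅ ℓ us)) burnt≡V)
      where
        agree₀ = Unburnt⇒AgreeOn-∅ unburnt
        legalᵤ = Legal-++⁻ G us legal

meeting-components-⊆ : ∀ {N} {H G G′ : Hypergraph N} {v} → IsComponent H G → IsComponent H G′ →
                       v ∈ V G → v ∈ V G′ → V G ⊆ V G′
meeting-components-⊆ {H = H} {G} {G′} isComponent isComponent′ v∈G v∈G′ w∈G =
  G′.∈V-closed v∈G′ (G.V⊆V w∈G) (G.connected v∈G w∈G)
  where
    module G  = ComponentOf H G isComponent
    module G′ = ComponentOf H G′ isComponent′

module Schedule {N} (H : Hypergraph N) (noSingleton : All (λ e → ∣ e ∣ ≢ 1) (E H))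
  {k} (G : Fin k → Hypergraph N) (isComponent : ∀ i → IsComponent H (G i))
  (V-injective : ∀ i j → V (G i) ≡ V (G j) → i ≡ j)
  (cover : ∀ x → x ∈ V H → ∃ λ i → x ∈ V (G i))
  (notIsolated : ∀ i → ¬ IsolatedVertex (G i))
  (seq : Fin k → List (Fin N)) (burns : ∀ i → IsBurningSeq (G i) (seq i)) where

  module C i = ComponentOf H (G i) (isComponent i)

  disjoint : ∀ {i j v} → v ∈ V (G i) → v ∈ V (G j) → i ≡ j
  disjoint {i} {j} v∈i v∈j = V-injective i j (⊆-antisym (meeting i j v∈i v∈j) (meeting j i v∈j v∈i))
    where
      meeting : ∀ i j {v} → v ∈ V (G i) → v ∈ V (G j) → V (G i) ⊆ V (G j)
      meeting i j = meeting-components-⊆ {H = H} {G i} {G j} (isComponent i) (isComponent j)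

  2≤length-seq : ∀ i → 2 ≤ length (seq i)
  2≤length-seq i with C.big-edge i noSingleton (notIsolated i) (proj₂ (nonempty (G i)))
  ... | e , e∈G , _ , 2≤∣e∣ = 2≤length-burningSeq (G i) (All.lookup (E⊆V (G i)) e∈G) 2≤∣e∣ (seq i) (burns i)

  seq≢[] : ∀ i → seq i ≢ []
  seq≢[] i seq≡[] with subst (λ s → 2 ≤ length s) seq≡[] (2≤length-seq i)
  ... | ()

  Invariant : List (Fin k) → Subset N → Set
  Invariant R F = F ⊆ V H × (∀ {i} → i ∈ₗ R → Unburnt (V (G i)) F) × (∀ {i} → i ∉ₗ R → Settled H (V (G i)) F)

  burn-last : ∀ j {F} → Invariant (j ∷ []) F → BurnsFrom H F (seq j)
  burn-last j {F} (F⊆V , unburnt , settled) with BurnsFrom⁻ (G j) (seq j) (burns j)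
  ... | legal , burnt≡V = BurnsFrom⁺ H (seq j) (C.Legal-lift j agree₀ (seq j) legal) (⊆-antisym burnt⊆V V⊆burnt)
    where
      agree₀ = Unburnt⇒AgreeOn-∅ (unburnt (here refl))
      burnt⊆V : run (E H) F (seq j) ⊆ V H
      burnt⊆V = run-⊆V H (seq j) F⊆V (Legal⇒sources∈V H (seq j) (C.Legal-lift j agree₀ (seq j) legal))
      V⊆burnt : V H ⊆ run (E H) F (seq j)
      V⊆burnt {v} v∈H with cover v v∈H
      ... | i , v∈i with i ≟ j
      ...   | yes refl = proj₂ (C.AgreeOn-run j agree₀ (seq j) v∈i) (subst (v ∈_) (sym burnt≡V) v∈i)
      ...   | no i≢j   = settled (λ { (here i≡j) → i≢j i≡j }) (seq j) (2≤length-seq j) v∈i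

  burn-first : ∀ j R {F} → All (j ≢_) R → Invariant (j ∷ R) F →
               ∃ λ us → suc (length us) ≡ length (seq j) × Legal H F us × Invariant R (run (E H) F us)
  burn-first j R {F} j∉R (F⊆V , unburnt , settled) with ∷ʳ-split (seq j) (seq≢[] j)
  ... | us , ℓ , seq≡ with C.burn-all-but-last j noSingleton (notIsolated j) (unburnt (here refl)) us ℓ
                             (subst (IsBurningSeq (G j)) seq≡ (burns j))
  ... | legal , us∈Gj , settledʲ =
    us , length-us , legal , run-⊆V H us F⊆V (Legal⇒sources∈V H us legal) , unburnt₁ , settled₁
    where
      length-us : suc (length us) ≡ length (seq j)
      length-us = sym (trans (cong length seq≡) (trans (length-++ us) (+-comm (length us) 1)))
      unburnt₁ : ∀ {i} → i ∈ₗ R → Unburnt (V (G i)) (run (E H) F us)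
      unburnt₁ {i} i∈R = C.Unburnt-run i (unburnt (there i∈R)) us
        (All.map (λ u∈j u∈i → All.lookup j∉R i∈R (disjoint u∈j u∈i)) us∈Gj)
      settled₁ : ∀ {i} → i ∉ₗ R → Settled H (V (G i)) (run (E H) F us)
      settled₁ {i} i∉R with i ≟ j
      ... | yes refl = settledʲ
      ... | no i≢j   = Settled-run H (settled λ { (here i≡j) → i≢j i≡j ; (there i∈R) → i∉R i∈R }) us

  schedule : ∀ R → Unique R → R ≢ [] → ∀ {F} → Invariant R F →
             ∃ λ us → BurnsFrom H F us × length us + length R ≡ sum (map (length ∘ seq) R) + 1
  schedule []              _                R≢[] _   = ⊥-elim (R≢[] refl)
  schedule (j ∷ [])        _                _    inv = seq j , burn-last j inv , cong (_+ 1) (sym (+-identityʳ _))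
  schedule (j ∷ R@(_ ∷ _)) (j∉R ∷ uniqueR) _    inv with burn-first j R j∉R inv
  ... | us , length-us , legal , inv₁ with schedule R uniqueR (λ ()) inv₁
  ... | rest , burnsRest , length-rest = us ++ rest , BurnsFrom-++ H us legal burnsRest , length-eq
    where
      open ≡-Reasoning
      length-eq : length (us ++ rest) + length (j ∷ R) ≡ sum (map (length ∘ seq) (j ∷ R)) + 1
      length-eq = begin
        length (us ++ rest) + suc (length R)               ≡⟨ cong (_+ suc (length R)) (length-++ us) ⟩
        (length us + length rest) + suc (length R)         ≡⟨ +-suc (length us + length rest) (length R) ⟩
        suc ((length us + length rest) + length R)         ≡⟨ cong suc (+-assoc (length us) (length rest) (length R)) ⟩
        suc (length us) + (length rest + length R)         ≡⟨ cong₂ _+_ length-us length-rest ⟩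
        length (seq j) + (sum (map (length ∘ seq) R) + 1)  ≡⟨ sym (+-assoc (length (seq j)) _ 1) ⟩
        sum (map (length ∘ seq) (j ∷ R)) + 1               ∎

  burn-in-turn : ∃ λ us → IsBurningSeq H us × length us + k ≡ sum (map (length ∘ seq) (allFin k)) + 1
  burn-in-turn with cover _ (proj₂ (nonempty H))
  ... | i₀ , _ with schedule (allFin k) (allFin⁺ k) allFin≢[] (⊥⊆ , (λ _ _ → ∉⊥) , λ i∉ → ⊥-elim (i∉ (∈-allFin _)))
    where
      allFin≢[] : allFin k ≢ []
      allFin≢[] allFin≡[] with subst (i₀ ∈ₗ_) allFin≡[] (∈-allFin i₀)
      ... | ()
  ... | us , burnsH , length-us = us , burnsH , trans (cong (length us +_) (sym (length-tabulate id))) length-us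

mainTheorem16 : ∀ {N} (H : Hypergraph N) →
    All (λ e → ∣ e ∣ ≢ 1) (E H) →
    Disconnected H →
    (k : ℕ) (G : Fin k → Hypergraph N) →
    (∀ i → IsComponent H (G i)) →
    (∀ i j → V (G i) ≡ V (G j) → i ≡ j) →
    (∀ x → x ∈ V H → ∃ λ i → x ∈ V (G i)) →
    (∀ i → ¬ IsolatedVertex (G i)) →
    (b : ℕ) (bs : Fin k → ℕ) →
    IsBurningNumber H b →
    (∀ i → IsBurningNumber (G i) (bs i)) →
    b + k ≤ (Σ[< k ] bs) + 1
mainTheorem16 H noSingleton _ k G isComponent V-injective cover notIsolated b bs (_ , minimal) optimal =
  let us , burnsH , length-us = Schedule.burn-in-turn H noSingleton G isComponent V-injective cover notIsolated seq burns
  in begin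
    b + k                                    ≤⟨ +-monoˡ-≤ k (minimal us burnsH) ⟩
    length us + k                            ≡⟨ length-us ⟩
    sum (map (length ∘ seq) (allFin k)) + 1  ≡⟨ cong (λ ls → sum ls + 1) (map-cong length-seq (allFin k)) ⟩
    sum (map bs (allFin k)) + 1              ≡⟨ cong (λ ls → sum ls + 1) (map-tabulate id bs) ⟩
    Σ[< k ] bs + 1                           ∎
  where
    open ≤-Reasoning
    seq : Fin k → List (Fin _)
    seq i = proj₁ (proj₁ (optimal i))
    burns : ∀ i → IsBurningSeq (G i) (seq i)
    burns i = proj₁ (proj₂ (proj₁ (optimal i)))
    length-seq : ∀ i → length (seq i) ≡ bs i
    length-seq i = proj₂ (proj₂ (proj₁ (optimal i)))
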